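{- Let $\phi$ be an NAE-E3-SAT formula over variables $v_1,\dots,v_n$ partitioned into universally quantified variables $V_A=\{v_1,\dots,v_{n'}\}$ and existentially quantified variables $V_E=\{v_{n'+1},\dots,v_n\}$, and let $A'=A'(\phi)$. Let $w:=\tfrac12\mathbf{1}\in\mathbb{R}^{3n}$, $w^*\in\{1/3,2/3\}^{n'}$, $x\in\mathbb{Z}^{3n}$, $x^*\in\mathbb{Z}^{n'}$, $w':=(w,w^*)$ and $x':=(x,x^*)$. If $\|A'(w'-x')\|_\infty<3/2$, then $x'\in\{0,1\}^{3n+n'}$.
   Context: Each constraint $C_1,\dots,C_m$ of $\phi$ is a function of exactly $3$ literals on distinct variables. Let $B\in\mathbb{R}^{m\times n}$ have $B_{i,j}=1$ if $C_i$ contains $v_j$, $-1$ if $C_i$ contains $\lnot v_j$, and $0$ otherwise. Let $G$ be the $3\times3$ matrix with rows $(1,1,-1),(1,-1,1),(-1,1,1)$, and $A_\infty(\phi)\in\mathbb{R}^{(m+3n)\times3n}$ the matrix with top block row $(\tfrac13B,\tfrac13B,\tfrac13B)$ and bottom block $G\otimes I_n$ (Kronecker product; for $x=(x^1,x^2,x^3)$ with $x^a\in\mathbb{R}^n$, the $a$-th block of $(G\otimes I_n)x$ is $\sum_bG_{a,b}x^b$). Then $A'(\phi)\in\mathbb{R}^{(m+3n+2n')\times(3n+n')}$ is the block matrix whose first $m+3n$ rows are $(A_\infty(\phi)\mid 0_{(m+3n)\times n'})$; whose next $n'$ rows are $(\tfrac23I_{n'}\ 0_{n'\times(n-n')}\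 \tfrac23I_{n'}\ 0_{n'\times(n-n')}\ \tfrac23I_{n'}\ 0_{n'\times(n-n')}\mid -2I_{n'})$; and whose last $n'$ rows are $(0_{n'\times3n}\mid \tfrac83I_{n'})$. $\mathbf{1}$ is the all-ones vector. -}

module Defs where

open import Data.Nat as ℕ using (ℕ; _≤_)
open import Data.Fin as Fin using (Fin; inject≤)
open import Data.Fin.Properties using () renaming (_≟_ to _≟ᶠ_)
open import Data.Bool using (Bool; true; false; if_then_else_)
open import Data.Product using (_×_; _,_; proj₁)
open import Data.Sum using (_⊎_; inj₁; inj₂)
open import Data.Integer using (ℤ; +_)
open import Data.Rational using (ℚ; 0ℚ; 1ℚ; ½; _+_; _*_; _-_; -_; _/_)
open import Relation.Nullary.Decidable using (⌊_⌋)
open import Relation.Binary.PropositionalEquality using (_≡_)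
open import Function using (_∘_)
open import Function.Definitions using (Injective)

-- A literal over variables v_1..v_n: (variable index, polarity);
-- polarity true = v_j, false = ¬ v_j.
Literal : ℕ → Set
Literal n = Fin n × Bool

record NAE-E3-SAT (n m : ℕ) : Set where
  field
    lit      : Fin m → Fin 3 → Literal n
    distinct : ∀ i → Injective _≡_ _≡_ (proj₁ ∘ lit i)
open NAE-E3-SAT public

sumFin : (k : ℕ) → (Fin k → ℚ) → ℚ
sumFin ℕ.zero    f = 0ℚ
sumFin (ℕ.suc k) f = f Fin.zero + sumFin k (f ∘ Fin.suc)

sign : Bool → ℚ
sign true  = 1ℚ
sign false = - 1ℚ

-- B_{i,j} = 1 if C_i contains v_j, -1 if C_i contains ¬v_j, 0 otherwise
-- (literals are on distinct variables, so at most one summand is nonzero)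
Bmat : ∀ {n m} → NAE-E3-SAT n m → Fin m → Fin n → ℚ
Bmat φ i j = sumFin 3 λ k →
  if ⌊ proj₁ (lit φ i k) ≟ᶠ j ⌋ then sign (Data.Product.proj₂ (lit φ i k)) else 0ℚ

G : Fin 3 → Fin 3 → ℚ
G Fin.zero Fin.zero = 1ℚ
G Fin.zero (Fin.suc Fin.zero) = 1ℚ
G Fin.zero (Fin.suc (Fin.suc Fin.zero)) = - 1ℚ
G (Fin.suc Fin.zero) Fin.zero = 1ℚ
G (Fin.suc Fin.zero) (Fin.suc Fin.zero) = - 1ℚ
G (Fin.suc Fin.zero) (Fin.suc (Fin.suc Fin.zero)) = 1ℚ
G (Fin.suc (Fin.suc Fin.zero)) Fin.zero = - 1ℚ
G (Fin.suc (Fin.suc Fin.zero)) (Fin.suc Fin.zero) = 1ℚ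
G (Fin.suc (Fin.suc Fin.zero)) (Fin.suc (Fin.suc Fin.zero)) = 1ℚ

-- Column index set of A'(φ), of size 3n + n':
--   inj₁ (a , j) = j-th coordinate of the a-th block x^a (a = 0,1,2),
--   inj₂ k       = k-th coordinate of the last block (x*).
Col : ℕ → ℕ → Set
Col n n' = (Fin 3 × Fin n) ⊎ Fin n'

-- Row index set of A'(φ), of size m + 3n + 2n':
--   inj₁ i                = row i of (B/3, B/3, B/3 | 0)
--   inj₂ (inj₁ (a , j))   = row (a , j) of (G ⊗ I_n | 0)
--   inj₂ (inj₂ (inj₁ k))  = row k of (2/3 I 0 2/3 I 0 2/3 I 0 | -2 I)
--   inj₂ (inj₂ (inj₂ k))  = row k of (0 | 8/3 I)
Row : ℕ → ℕ → ℕ → Set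
Row m n n' = Fin m ⊎ ((Fin 3 × Fin n) ⊎ (Fin n' ⊎ Fin n'))

δ : ∀ {k} → Fin k → Fin k → ℚ → ℚ
δ i j q = if ⌊ i ≟ᶠ j ⌋ then q else 0ℚ

A' : ∀ {n m} (n' : ℕ) → n' ≤ n → NAE-E3-SAT n m → Row m n n' → Col n n' → ℚ
A' n' le φ (inj₁ i)                (inj₁ (a , j)) = (+ 1 / 3) * Bmat φ i j
A' n' le φ (inj₁ i)                (inj₂ k)       = 0ℚ
A' n' le φ (inj₂ (inj₁ (a , j')))  (inj₁ (b , j)) = δ j' j (G a b)
A' n' le φ (inj₂ (inj₁ (a , j')))  (inj₂ k)       = 0ℚ
A' n' le φ (inj₂ (inj₂ (inj₁ i)))  (inj₁ (a , j)) = δ (inject≤ i le) j (+ 2 / 3)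
A' n' le φ (inj₂ (inj₂ (inj₁ i)))  (inj₂ k)       = δ i k (- (+ 2 / 1))
A' n' le φ (inj₂ (inj₂ (inj₂ i)))  (inj₁ (a , j)) = 0ℚ
A' n' le φ (inj₂ (inj₂ (inj₂ i)))  (inj₂ k)       = δ i k (+ 8 / 3)

sumCol : ∀ n n' → (Col n n' → ℚ) → ℚ
sumCol n n' f = sumFin 3 (λ a → sumFin n (λ j → f (inj₁ (a , j))))
              + sumFin n' (λ k → f (inj₂ k))

_·_ : ∀ {R : Set} {n n'} → (R → Col n n' → ℚ) → (Col n n' → ℚ) → R → ℚ
_·_ {n = n} {n'} M v r = sumCol n n' (λ c → M r c * v c)

ℤ→ℚ : ℤ → ℚ
ℤ→ℚ z = z / 1

w'-x' : ∀ {n n'} → (Fin n' → ℚ) → (Fin 3 → Fin n → ℤ) → (Fin n' → ℤ) → Col n n' → ℚ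
w'-x' wstar x xstar (inj₁ (a , j)) = ½ - ℤ→ℚ (x a j)
w'-x' wstar x xstar (inj₂ k)       = wstar k - ℤ→ℚ (xstar k)

-- The rows of A'(φ) indexed by G ⊗ I_n give, for every variable j, bounds
-- |(G y)_a| < 3/2 on the triple y = (½ - x¹_j, ½ - x²_j, ½ - x³_j).  Any two
-- rows of G add up to twice a unit vector, so |½ - xᵃ_j| < 3/2, which leaves
-- only xᵃ_j ∈ {0, 1}.  Likewise the last block of rows gives
-- |w*_k - x*_k| < 9/16, and w*_k ∈ {1/3, 2/3} again forces x*_k ∈ {0, 1}.
module Submission where

open import Defs
open import Data.Nat using (ℕ; _≤_; zero; suc; s≤s)
open import Data.Fin using (Fin; zero; suc)
open import Data.Fin.Properties using () renaming (_≟_ to _≟ᶠ_)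
open import Data.Product using (_,_; _×_; ∃₂; proj₁; proj₂)
open import Data.Sum using (_⊎_; inj₁; inj₂)
open import Data.Integer as ℤ using (ℤ; +_; -[1+_]; +[1+_])
open import Data.Integer.Properties using () renaming (*-identityʳ to ℤ-*-identityʳ)
open import Data.Rational as ℚ using (ℚ; mkℚ; 0ℚ; 1ℚ; ½; _+_; _*_; _-_; -_; _/_; _<_; ∣_∣; NonNegative)
open import Data.Rational.Properties
import Data.Rational.Unnormalised as ℚᵘ
import Data.Rational.Unnormalised.Properties as ℚᵘ
open import Algebra.Bundles using (CommutativeMonoid)
open import Algebra.Properties.CommutativeSemigroup
  (CommutativeMonoid.commutativeSemigroup +-0-commutativeMonoid) using (interchange)
open import Algebra.Properties.AbelianGroup +-0-abelianGroup using (⁻¹-anti-homo‿-; xyx⁻¹≈y)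
open import Relation.Binary.PropositionalEquality
open import Relation.Nullary.Decidable using (yes; no)
open import Function using (_∘_)

sumFin-cong : ∀ k {f g : Fin k → ℚ} → (∀ i → f i ≡ g i) → sumFin k f ≡ sumFin k g
sumFin-cong zero    f≗g = refl
sumFin-cong (suc k) f≗g = cong₂ _+_ (f≗g zero) (sumFin-cong k (f≗g ∘ suc))

sumFin-zero : ∀ k {f : Fin k → ℚ} → (∀ i → f i ≡ 0ℚ) → sumFin k f ≡ 0ℚ
sumFin-zero zero    f≗0 = refl
sumFin-zero (suc k) f≗0 = cong₂ _+_ (f≗0 zero) (sumFin-zero k (f≗0 ∘ suc))

sumFin-+ : ∀ k (f g : Fin k → ℚ) → sumFin k f + sumFin k g ≡ sumFin k (λ i → f i + g i)
sumFin-+ zero    f g = refl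
sumFin-+ (suc k) f g = trans (interchange (f zero) _ (g zero) _)
                             (cong (_+_ (f zero + g zero)) (sumFin-+ k (f ∘ suc) (g ∘ suc)))

δ-suc : ∀ {k} (i j : Fin k) q → δ (suc i) (suc j) q ≡ δ i j q
δ-suc i j q with i ≟ᶠ j
... | yes _ = refl
... | no  _ = refl

sumFin-δ : ∀ k (i : Fin k) q (f : Fin k → ℚ) → sumFin k (λ j → δ i j q * f j) ≡ q * f i
sumFin-δ (suc k) zero    q f =
  trans (cong (_+_ (q * f zero)) (sumFin-zero k (λ j → *-zeroˡ (f (suc j))))) (+-identityʳ _)
sumFin-δ (suc k) (suc i) q f = begin
  0ℚ * f zero + sumFin k (λ j → δ (suc i) (suc j) q * f (suc j))
    ≡⟨ cong₂ _+_ (*-zeroˡ (f zero)) (sumFin-cong k (λ j → cong (_* f (suc j)) (δ-suc i j q))) ⟩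
  0ℚ + sumFin k (λ j → δ i j q * f (suc j))
    ≡⟨ +-identityˡ _ ⟩
  sumFin k (λ j → δ i j q * f (suc j))
    ≡⟨ sumFin-δ k i q (f ∘ suc) ⟩
  q * f (suc i) ∎
  where open ≡-Reasoning

dot : ∀ {k} → (Fin k → ℚ) → (Fin k → ℚ) → ℚ
dot {k} r y = sumFin k (λ b → r b * y b)

dot-+-unit : ∀ {k} (r s y : Fin k → ℚ) c q → (∀ b → r b + s b ≡ δ c b q) →
             dot r y + dot s y ≡ q * y c
dot-+-unit {k} r s y c q r+s≡qe = begin
  dot r y + dot s y                      ≡⟨ sumFin-+ k _ _ ⟩
  sumFin k (λ b → r b * y b + s b * y b) ≡⟨ sumFin-cong k (λ b → sym (*-distribʳ-+ (y b) (r b) (s b))) ⟩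
  sumFin k (λ b → (r b + s b) * y b)     ≡⟨ sumFin-cong k (λ b → cong (_* y b) (r+s≡qe b)) ⟩
  sumFin k (λ b → δ c b q * y b)         ≡⟨ sumFin-δ k c q y ⟩
  q * y c                                ∎
  where open ≡-Reasoning

G-rows-sum : ∀ c → ∃₂ λ a a' → ∀ b → G a b + G a' b ≡ δ c b (+ 2 / 1)
G-rows-sum zero             = zero , suc zero ,
  λ { zero → refl ; (suc zero) → refl ; (suc (suc zero)) → refl }
G-rows-sum (suc zero)       = zero , suc (suc zero) ,
  λ { zero → refl ; (suc zero) → refl ; (suc (suc zero)) → refl }
G-rows-sum (suc (suc zero)) = suc zero , suc (suc zero) ,
  λ { zero → refl ; (suc zero) → refl ; (suc (suc zero)) → refl }

∣c*p∣<c*r⇒∣p∣<r : ∀ c .{{_ : NonNegative c}} {p r} → ∣ c * p ∣ < c * r → ∣ p ∣ < r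
∣c*p∣<c*r⇒∣p∣<r c {p} {r} ∣cp∣<cr = *-cancelˡ-<-nonNeg c (subst (_< c * r) ∣cp∣≡c∣p∣ ∣cp∣<cr)
  where
  ∣cp∣≡c∣p∣ : ∣ c * p ∣ ≡ c * ∣ p ∣
  ∣cp∣≡c∣p∣ = trans (∣p*q∣≡∣p∣*∣q∣ c p) (cong (_* ∣ p ∣) (0≤p⇒∣p∣≡p (nonNegative⁻¹ c)))

∣p+q∣<r+s : ∀ {p q r s} → ∣ p ∣ < r → ∣ q ∣ < s → ∣ p + q ∣ < r + s
∣p+q∣<r+s {p} {q} ∣p∣<r ∣q∣<s = ≤-<-trans (∣p+q∣≤∣p∣+∣q∣ p q) (+-mono-< ∣p∣<r ∣q∣<s)

p≤∣p∣ : ∀ p → p ℚ.≤ ∣ p ∣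
p≤∣p∣ (mkℚ (+ _)      _ _) = ≤-refl
p≤∣p∣ p@(mkℚ -[1+ _ ] _ _) = ≤-trans (<⇒≤ (negative⁻¹ p)) (0≤∣p∣ p)

-- ℤ→ℚ i = i / 1 is definitionally fromℚᵘ (mkℚᵘ i 0).
ℤ→ℚ-cancel-< : ∀ {i j} → ℤ→ℚ i < ℤ→ℚ j → i ℤ.< j
ℤ→ℚ-cancel-< {i} {j} i<j with ℚᵘ.<-respˡ-≃ (toℚᵘ-fromℚᵘ (ℚᵘ.mkℚᵘ i 0))
                                (ℚᵘ.<-respʳ-≃ (toℚᵘ-fromℚᵘ (ℚᵘ.mkℚᵘ j 0)) (toℚᵘ-mono-< i<j))
... | ℚᵘ.*<* i*1<j*1 = subst₂ ℤ._<_ (ℤ-*-identityʳ i) (ℤ-*-identityʳ j) i*1<j*1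

IsBit : ℤ → Set
IsBit i = i ≡ + 0 ⊎ i ≡ + 1

-1<i<2⇒bit : ∀ {i} → -[1+ 0 ] ℤ.< i → i ℤ.< + 2 → IsBit i
-1<i<2⇒bit {+ 0}          _           _                      = inj₁ refl
-1<i<2⇒bit {+ 1}          _           _                      = inj₂ refl
-1<i<2⇒bit {+[1+ suc _ ]} _           (ℤ.+<+ (s≤s (s≤s ())))
-1<i<2⇒bit { -[1+ _ ]}    (ℤ.-<- ())  _

∣q-i∣<r⇒bit : ∀ q r i → - 1ℚ ℚ.≤ q - r → q + r ℚ.≤ + 2 / 1 → ∣ q - ℤ→ℚ i ∣ < r → IsBit i
∣q-i∣<r⇒bit q r i -1≤q-r q+r≤2 ∣t∣<r = -1<i<2⇒bit (ℤ→ℚ-cancel-< -1<i) (ℤ→ℚ-cancel-< i<2)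
  where
  t : ℚ
  t = q - ℤ→ℚ i
  q-t≡i : q - t ≡ ℤ→ℚ i
  q-t≡i = trans (cong (_+_ q) (⁻¹-anti-homo‿- q (ℤ→ℚ i)))
                (trans (sym (+-assoc q (ℤ→ℚ i) (- q))) (xyx⁻¹≈y q (ℤ→ℚ i)))
  -t<r : - t < r
  -t<r = ≤-<-trans (p≤∣p∣ (- t)) (subst (_< r) (sym (∣-p∣≡∣p∣ t)) ∣t∣<r)
  -1<i : - 1ℚ < ℤ→ℚ i
  -1<i = ≤-<-trans -1≤q-r (subst (q - r <_) q-t≡i (+-monoʳ-< q (neg-antimono-< (≤-<-trans (p≤∣p∣ t) ∣t∣<r))))
  i<2 : ℤ→ℚ i < + 2 / 1
  i<2 = <-≤-trans (subst (_< q + r) q-t≡i (+-monoʳ-< q -t<r)) q+r≤2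

triple : ∀ {n n'} → (Col n n' → ℚ) → Fin n → Fin 3 → ℚ
triple v j b = v (inj₁ (b , j))

module _ {n m n'} (le : n' ≤ n) (φ : NAE-E3-SAT n m) where

  ·-G⊗I-row : ∀ v a j → (A' n' le φ · v) (inj₂ (inj₁ (a , j))) ≡ dot (G a) (triple v j)
  ·-G⊗I-row v a j = trans
    (cong₂ _+_ (sumFin-cong 3 (λ b → sumFin-δ n j (G a b) (λ i → v (inj₁ (b , i)))))
               (sumFin-zero n' (λ k → *-zeroˡ (v (inj₂ k)))))
    (+-identityʳ _)

  ·-last-row : ∀ v k → (A' n' le φ · v) (inj₂ (inj₂ (inj₂ k))) ≡ + 8 / 3 * v (inj₂ k)
  ·-last-row v k = trans
    (cong₂ _+_ (sumFin-zero 3 (λ a → sumFin-zero n (λ j → *-zeroˡ (v (inj₁ (a , j))))))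
               (sumFin-δ n' k (+ 8 / 3) (λ i → v (inj₂ i))))
    (+-identityˡ _)

lemma4p5 : (n m n' : ℕ) (le : n' ≤ n) (φ : NAE-E3-SAT n m)
    (wstar : Fin n' → ℚ) → (∀ k → wstar k ≡ + 1 / 3 ⊎ wstar k ≡ + 2 / 3)
    → (x : Fin 3 → Fin n → ℤ) (xstar : Fin n' → ℤ)
    → (∀ r → ∣ (A' n' le φ · w'-x' wstar x xstar) r ∣ < + 3 / 2)
    → (∀ a j → x a j ≡ + 0 ⊎ x a j ≡ + 1) × (∀ k → xstar k ≡ + 0 ⊎ xstar k ≡ + 1)
lemma4p5 n m n' le φ wstar hw x xstar bound = x-bit , xstar-bit
  where
  v : Col n n' → ℚ
  v = w'-x' wstar x xstar

  G-row-bound : ∀ a j → ∣ dot (G a) (triple v j) ∣ < + 3 / 2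
  G-row-bound a j = subst (λ t → ∣ t ∣ < + 3 / 2) (·-G⊗I-row le φ v a j) (bound (inj₂ (inj₁ (a , j))))

  -- The closed rational side conditions hold by evaluation: ½ ∓ 3/2 = -1, 2,
  -- 3/2 + 3/2 = 2 · 3/2 and, below, 8/3 · 9/16 = 3/2.
  x-bit : ∀ c j → IsBit (x c j)
  x-bit c j with G-rows-sum c
  ... | a , a' , rows-sum = ∣q-i∣<r⇒bit ½ (+ 3 / 2) (x c j) ≤-refl ≤-refl
    (∣c*p∣<c*r⇒∣p∣<r (+ 2 / 1)
      (subst (λ t → ∣ t ∣ < + 3 / 2 + + 3 / 2) (dot-+-unit (G a) (G a') (triple v j) c (+ 2 / 1) rows-sum)
        (∣p+q∣<r+s (G-row-bound a j) (G-row-bound a' j))))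

  window : ∀ {w} → w ≡ + 1 / 3 ⊎ w ≡ + 2 / 3 → - 1ℚ ℚ.≤ w - + 9 / 16 × w + + 9 / 16 ℚ.≤ + 2 / 1
  window (inj₁ refl) = ≤ᵇ⇒≤ _ , ≤ᵇ⇒≤ _
  window (inj₂ refl) = ≤ᵇ⇒≤ _ , ≤ᵇ⇒≤ _

  xstar-bit : ∀ k → IsBit (xstar k)
  xstar-bit k = ∣q-i∣<r⇒bit (wstar k) (+ 9 / 16) (xstar k) (proj₁ (window (hw k))) (proj₂ (window (hw k)))
    (∣c*p∣<c*r⇒∣p∣<r (+ 8 / 3)
      (subst (λ t → ∣ t ∣ < + 3 / 2) (·-last-row le φ v k) (bound (inj₂ (inj₂ (inj₂ k))))))
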